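{- Let $k\ge 0$ be an integer. For every integer $n\ge 0$, $$H_n^{(k)}=\sum_{0\le j\le n}\left(\sum_{0\le m\le j+1}\left[{j+1\atop m}\right]S^{*}(k+2,j)\,\frac{(-1)^{j+1-m}(n+1)^m}{j+1}\right).$$
   Context: For integers $k\ge 2$ and $j\ge 1$, $S^{*}(k,j)=\frac{1}{j!}\sum_{m=1}^{j}\binom{j}{m}\frac{(-1)^{j-m}}{m^{k-2}}$, and $S^{*}(k,0)=0$ for $k\ge2$. For integer $s$ and $n\ge0$, $H_n^{(s)}=\sum_{i=1}^{n} i^{ -s}$. The symbol $\left[{n\atop m}\right]$ denotes the unsigned Stirling numbers of the first kind, i.e. $x(x+1)\cdots(x+n-1)=\sum_{m=0}^{n}\left[{n\atop m}\right]x^m$. -}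

module Defs where

open import Data.Nat as ℕ using (ℕ; zero; suc; _∸_)
open import Data.Nat.Combinatorics using (_C_)
open import Data.Nat using (_!)
open import Data.Integer as ℤ using (ℤ; +_)
open import Data.Rational using (ℚ; _/_; _+_; _*_; -_; 0ℚ; 1ℚ)

nat : ℕ → ℚ
nat n = (+ n) / 1

-- reciprocal 1/d of a natural number (only used for d ≥ 1; 1/0 := 0 by convention)
inv : ℕ → ℚ
inv zero    = 0ℚ
inv (suc d) = (+ 1) / suc d

negOnePow : ℕ → ℚ
negOnePow zero    = 1ℚ
negOnePow (suc e) = - negOnePow e

-- sumRange a b f = Σ_{a ≤ i ≤ b} f i   (empty if b < a)
sumFrom : ℕ → ℕ → (ℕ → ℚ) → ℚ
sumFrom a zero    f = 0ℚ
sumFrom a (suc c) f = f a + sumFrom (suc a) c f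

sumRange : ℕ → ℕ → (ℕ → ℚ) → ℚ
sumRange a b f = sumFrom a (suc b ∸ a) f

-- unsigned Stirling numbers of the first kind [n m]:
-- x(x+1)…(x+n-1) = Σ_m [n m] x^m
stirling1 : ℕ → ℕ → ℕ
stirling1 zero    zero    = 1
stirling1 zero    (suc m) = 0
stirling1 (suc n) zero    = 0
stirling1 (suc n) (suc m) = n ℕ.* stirling1 n (suc m) ℕ.+ stirling1 n m

-- S*(k,j) = (1/j!) Σ_{m=1}^{j} C(j,m) (-1)^{j-m} / m^{k-2}   (used for k ≥ 2)
Sstar : ℕ → ℕ → ℚ
Sstar k j = inv (j !) * sumRange 1 j (λ m → nat (j C m) * negOnePow (j ∸ m) * inv (m ℕ.^ (k ∸ 2)))

H : ℕ → ℕ → ℚ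
H n s = sumRange 1 n (λ i → inv (i ℕ.^ s))

module Submission where

open import Defs
open import Data.Nat as ℕ using (ℕ; _∸_; zero; suc; _!; _≤_; _<_; s≤s; z≤n)
open import Data.Rational using (ℚ; _*_)
open import Relation.Binary.PropositionalEquality using (_≡_)

import Data.Nat.Properties as ℕₚ
import Data.Nat.Tactic.RingSolver as ℕ-Tactic
open import Data.Nat.Combinatorics using (_C_; nCk+nC[k+1]≡[n+1]C[k+1]; nC1≡n; k>n⇒nCk≡0)
open import Data.Nat.Coprimality using (1-coprimeTo) renaming (sym to coprime-sym)
import Data.Integer as ℤ
import Data.Integer.Properties as ℤₚ
open import Data.Rational using (mkℚ; _/_; _+_; -_; 0ℚ; 1ℚ)
import Data.Rational.Properties as ℚₚ
open import Data.Rational.Solver using (module +-*-Solver)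
open +-*-Solver
open import Function using (_∘_)
open import Relation.Binary.PropositionalEquality using (refl; sym; trans; subst; cong; cong₂; module ≡-Reasoning)
open ≡-Reasoning

-- Put f(0) = 0 and f(i) = i^(-k) for i ≥ 1, so that H_n^(k) = Σ_{i ≤ n} f(i).  Summing Newton's
-- forward-difference formula gives Σ_{i ≤ n} f(i) = Σ_j C(n+1, j+1) Δʲf(0), and expanding
-- Δʲf(0) = Σ_m C(j,m) (-1)^(j-m) f(m) shows Δʲf(0) = j! S*(k+2, j).  On the other side,
-- Σ_m [j+1 m] (-1)^(j+1-m) X^m is the falling factorial X(X-1)⋯(X-j) = (j+1)! C(X, j+1),
-- so with X = n+1 the j-th summand of the right-hand side is C(n+1, j+1) Δʲf(0) as well.

nat′ : ℕ → ℚ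
nat′ n = mkℚ (ℤ.+ n) 0 (coprime-sym (1-coprimeTo n))

nat≡nat′ : ∀ n → nat n ≡ nat′ n
nat≡nat′ n = ℚₚ.↥p/↧p≡p (nat′ n)

nat-+ : ∀ a b → nat (a ℕ.+ b) ≡ nat a + nat b
nat-+ a b = begin
  nat (a ℕ.+ b)
    ≡⟨ cong (_/ 1) (cong₂ ℤ._+_ (ℤₚ.*-identityʳ (ℤ.+ a)) (ℤₚ.*-identityʳ (ℤ.+ b))) ⟨
  (ℤ.+ a ℤ.* ℤ.+ 1 ℤ.+ ℤ.+ b ℤ.* ℤ.+ 1) / 1  ≡⟨⟩
  nat′ a + nat′ b                             ≡⟨ cong₂ _+_ (nat≡nat′ a) (nat≡nat′ b) ⟨
  nat a + nat b                               ∎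

nat-* : ∀ a b → nat (a ℕ.* b) ≡ nat a * nat b
nat-* a b = begin
  nat (a ℕ.* b)              ≡⟨ cong (_/ 1) (ℤₚ.pos-* a b) ⟩
  (ℤ.+ a ℤ.* ℤ.+ b) / 1      ≡⟨⟩
  nat′ a * nat′ b            ≡⟨ cong₂ _*_ (nat≡nat′ a) (nat≡nat′ b) ⟨
  nat a * nat b              ∎

inv-*-nat : ∀ n .{{_ : ℕ.NonZero n}} → inv n * nat n ≡ 1ℚ
inv-*-nat (suc d) = trans
  (cong₂ _*_ (ℚₚ.↥p/↧p≡p (mkℚ (ℤ.+ 1) d (1-coprimeTo (suc d)))) (nat≡nat′ (suc d)))
  (ℚₚ.*-inverseˡ (nat′ (suc d)))

sumFrom-cong : ∀ a c {f g : ℕ → ℚ} → (∀ i → f i ≡ g i) → sumFrom a c f ≡ sumFrom a c g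
sumFrom-cong a zero    eq = refl
sumFrom-cong a (suc c) eq = cong₂ _+_ (eq a) (sumFrom-cong (suc a) c eq)

sumFrom-cong-on : ∀ a c {f g : ℕ → ℚ} → (∀ i → a ≤ i → i < a ℕ.+ c → f i ≡ g i) →
                  sumFrom a c f ≡ sumFrom a c g
sumFrom-cong-on a zero    eq = refl
sumFrom-cong-on a (suc c) eq = cong₂ _+_
  (eq a ℕₚ.≤-refl (ℕₚ.m<m+n a (s≤s z≤n)))
  (sumFrom-cong-on (suc a) c λ i a<i i<1+a+c →
    eq i (ℕₚ.<⇒≤ a<i) (subst (i <_) (sym (ℕₚ.+-suc a c)) i<1+a+c))

sumFrom-shift : ∀ a c f → sumFrom (suc a) c f ≡ sumFrom a c (f ∘ suc)
sumFrom-shift a zero    f = refl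
sumFrom-shift a (suc c) f = cong (f (suc a) +_) (sumFrom-shift (suc a) c f)

sumFrom-snoc : ∀ a c f → sumFrom a (suc c) f ≡ sumFrom a c f + f (a ℕ.+ c)
sumFrom-snoc a zero    f = trans (ℚₚ.+-identityʳ (f a))
  (trans (cong f (sym (ℕₚ.+-identityʳ a))) (sym (ℚₚ.+-identityˡ _)))
sumFrom-snoc a (suc c) f = begin
  f a + sumFrom (suc a) (suc c) f                    ≡⟨ cong (f a +_) (sumFrom-snoc (suc a) c f) ⟩
  f a + (sumFrom (suc a) c f + f (suc a ℕ.+ c))      ≡⟨ ℚₚ.+-assoc (f a) _ _ ⟨
  f a + sumFrom (suc a) c f + f (suc a ℕ.+ c)        ≡⟨ cong (λ i → f a + sumFrom (suc a) c f + f i) (ℕₚ.+-suc a c) ⟨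
  f a + sumFrom (suc a) c f + f (a ℕ.+ suc c)        ∎

sumFrom-+ : ∀ a c f g → sumFrom a c (λ i → f i + g i) ≡ sumFrom a c f + sumFrom a c g
sumFrom-+ a zero    f g = sym (ℚₚ.+-identityʳ 0ℚ)
sumFrom-+ a (suc c) f g = trans (cong (f a + g a +_) (sumFrom-+ (suc a) c f g))
  (solve 4 (λ x y u v → (x :+ y) :+ (u :+ v) := (x :+ u) :+ (y :+ v)) refl (f a) (g a) _ _)

sumFrom-*ˡ : ∀ a c x f → sumFrom a c (λ i → x * f i) ≡ x * sumFrom a c f
sumFrom-*ˡ a zero    x f = sym (ℚₚ.*-zeroʳ x)
sumFrom-*ˡ a (suc c) x f =
  trans (cong (x * f a +_) (sumFrom-*ˡ (suc a) c x f)) (sym (ℚₚ.*-distribˡ-+ x _ _))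

sumFrom-neg : ∀ a c f → sumFrom a c (λ i → - f i) ≡ - sumFrom a c f
sumFrom-neg a zero    f = refl
sumFrom-neg a (suc c) f =
  trans (cong (- f a +_) (sumFrom-neg (suc a) c f)) (sym (ℚₚ.neg-distrib-+ (f a) _))

altSum : ℕ → (ℕ → ℚ) → (ℕ → ℚ) → ℚ
altSum j c h = sumFrom 0 (suc j) (λ m → c m * negOnePow (j ∸ m) * h m)

altSum-suc : ∀ j c h →
  altSum (suc j) c h ≡ c 0 * negOnePow (suc j) * h 0 + altSum j (c ∘ suc) (h ∘ suc)
altSum-suc j c h = cong (c 0 * negOnePow (suc j) * h 0 +_)
  (sumFrom-shift 0 (suc j) (λ m → c m * negOnePow (suc j ∸ m) * h m))

altSum-shift : ∀ j c h → c (suc j) ≡ 0ℚ →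
  altSum j (c ∘ suc) (h ∘ suc) ≡ c 0 * negOnePow j * h 0 + - altSum j c h
altSum-shift j c h c[1+j]≡0 = begin
  sumFrom 0 (suc j) F                      ≡⟨ sumFrom-snoc 0 j F ⟩
  sumFrom 0 j F + F j                      ≡⟨ cong₂ _+_ (sumFrom-cong-on 0 j F≡-G) F[j]≡0 ⟩
  sumFrom 0 j (λ m → - G m) + 0ℚ           ≡⟨ cong (_+ 0ℚ) (sumFrom-neg 0 j G) ⟩
  - sumFrom 0 j G + 0ℚ
    ≡⟨ solve 2 (λ t s → :- s :+ con 0ℚ := t :+ :- (t :+ s)) refl lead (sumFrom 0 j G) ⟩
  lead + - (lead + sumFrom 0 j G)
    ≡⟨ cong (λ s → lead + - (lead + s)) (sumFrom-shift 0 j (λ m → c m * negOnePow (j ∸ m) * h m)) ⟨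
  lead + - altSum j c h                    ∎
  where
  lead : ℚ
  lead = c 0 * negOnePow j * h 0
  F G : ℕ → ℚ
  F m = c (suc m) * negOnePow (j ∸ m) * h (suc m)
  G m = c (suc m) * negOnePow (j ∸ suc m) * h (suc m)
  F[j]≡0 : F j ≡ 0ℚ
  F[j]≡0 = trans (cong (λ z → z * negOnePow (j ∸ j) * h (suc j)) c[1+j]≡0)
    (solve 2 (λ e y → con 0ℚ :* e :* y := con 0ℚ) refl (negOnePow (j ∸ j)) (h (suc j)))
  F≡-G : ∀ m → 0 ≤ m → m < j → F m ≡ - G m
  F≡-G m _ m<j = trans
    (cong (λ e → c (suc m) * negOnePow e * h (suc m)) (ℕₚ.+-∸-assoc 1 m<j))
    (solve 3 (λ x e y → x :* (:- e) :* y := :- (x :* e :* y)) refl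
      (c (suc m)) (negOnePow (j ∸ suc m)) (h (suc m)))

stirling1-vanishes : ∀ {j m} → j < m → stirling1 j m ≡ 0
stirling1-vanishes {zero}  {suc m} _         = refl
stirling1-vanishes {suc j} {suc m} (s≤s j<m) = cong₂ ℕ._+_
  (trans (cong (j ℕ.*_) (stirling1-vanishes (ℕₚ.m<n⇒m<1+n j<m))) (ℕₚ.*-zeroʳ j))
  (stirling1-vanishes j<m)

n*stirling1[n,0]≡0 : ∀ n → n ℕ.* stirling1 n 0 ≡ 0
n*stirling1[n,0]≡0 zero    = refl
n*stirling1[n,0]≡0 (suc n) = ℕₚ.*-zeroʳ (suc n)

stirlingExpansion : ℕ → ℕ → ℚ
stirlingExpansion j X = altSum j (nat ∘ stirling1 j) (λ m → nat (X ℕ.^ m))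

stirlingExpansion-suc : ∀ j X →
  stirlingExpansion (suc j) X ≡ (nat X + - nat j) * stirlingExpansion j X
stirlingExpansion-suc j X = begin
  altSum (suc j) c′ h
    ≡⟨ altSum-suc j c′ h ⟩
  0ℚ * negOnePow (suc j) * h 0 + altSum j (c′ ∘ suc) (h ∘ suc)
    ≡⟨ cong₂ _+_ (solve 2 (λ e y → con 0ℚ :* e :* y := con 0ℚ) refl (negOnePow (suc j)) (h 0))
                 (sumFrom-cong 0 (suc j) recurrence) ⟩
  0ℚ + sumFrom 0 (suc j) (λ m → nat j * A m + nat X * B m)
    ≡⟨ cong (0ℚ +_) (trans (sumFrom-+ 0 (suc j) (λ m → nat j * A m) (λ m → nat X * B m))
         (cong₂ _+_ (sumFrom-*ˡ 0 (suc j) (nat j) A) (sumFrom-*ˡ 0 (suc j) (nat X) B))) ⟩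
  0ℚ + (nat j * altSum j (c ∘ suc) (h ∘ suc) + nat X * P)
    ≡⟨ cong (λ s → 0ℚ + (nat j * s + nat X * P)) (altSum-shift j c h c[1+j]≡0) ⟩
  0ℚ + (nat j * (c 0 * negOnePow j * h 0 + - P) + nat X * P)
    ≡⟨ solve 6 (λ t c₀ e y p x → con 0ℚ :+ (t :* (c₀ :* e :* y :+ :- p) :+ x :* p)
                                 := (x :+ :- t) :* p :+ (t :* c₀) :* e :* y)
         refl (nat j) (c 0) (negOnePow j) (h 0) P (nat X) ⟩
  (nat X + - nat j) * P + (nat j * c 0) * negOnePow j * h 0
    ≡⟨ cong (λ z → (nat X + - nat j) * P + z * negOnePow j * h 0)
         (trans (sym (nat-* j (stirling1 j 0))) (cong nat (n*stirling1[n,0]≡0 j))) ⟩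
  (nat X + - nat j) * P + 0ℚ * negOnePow j * h 0
    ≡⟨ solve 3 (λ q e y → q :+ con 0ℚ :* e :* y := q) refl ((nat X + - nat j) * P) (negOnePow j) (h 0) ⟩
  (nat X + - nat j) * P ∎
  where
  c c′ h A B : ℕ → ℚ
  c m = nat (stirling1 j m)
  c′ m = nat (stirling1 (suc j) m)
  h m = nat (X ℕ.^ m)
  A m = c (suc m) * negOnePow (j ∸ m) * h (suc m)
  B m = c m * negOnePow (j ∸ m) * h m
  P : ℚ
  P = stirlingExpansion j X
  c[1+j]≡0 : c (suc j) ≡ 0ℚ
  c[1+j]≡0 = cong nat (stirling1-vanishes (ℕₚ.n<1+n j))
  recurrence : ∀ m → c′ (suc m) * negOnePow (j ∸ m) * h (suc m) ≡ nat j * A m + nat X * B m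
  recurrence m = begin
    nat (j ℕ.* stirling1 j (suc m) ℕ.+ stirling1 j m) * e * nat (X ℕ.* X ℕ.^ m)
      ≡⟨ cong₂ (λ u v → u * e * v)
           (trans (nat-+ (j ℕ.* stirling1 j (suc m)) (stirling1 j m)) (cong (_+ c m) (nat-* j (stirling1 j (suc m))))) (nat-* X (X ℕ.^ m)) ⟩
    (nat j * c (suc m) + c m) * e * (nat X * h m)
      ≡⟨ solve 6 (λ t c₁ c₀ e x y → (t :* c₁ :+ c₀) :* e :* (x :* y)
                                    := t :* (c₁ :* e :* (x :* y)) :+ x :* (c₀ :* e :* y))
           refl (nat j) (c (suc m)) (c m) e (nat X) (h m) ⟩
    nat j * (c (suc m) * e * (nat X * h m)) + nat X * B m
      ≡⟨ cong (λ v → nat j * (c (suc m) * e * v) + nat X * B m) (nat-* X (X ℕ.^ m)) ⟨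
    nat j * A m + nat X * B m ∎
    where
    e : ℚ
    e = negOnePow (j ∸ m)

C-absorption : ∀ X j → X ℕ.* (X C j) ≡ suc j ℕ.* (X C suc j) ℕ.+ j ℕ.* (X C j)
C-absorption zero    zero    = refl
C-absorption zero    (suc j) = sym (cong₂ ℕ._+_ (ℕₚ.*-zeroʳ (suc (suc j))) (ℕₚ.*-zeroʳ (suc j)))
C-absorption (suc X) zero    = begin
  suc X ℕ.* 1                         ≡⟨ ℕₚ.*-identityʳ (suc X) ⟩
  suc X                               ≡⟨ nC1≡n (suc X) ⟨
  suc X C 1                           ≡⟨ ℕₚ.*-identityˡ _ ⟨
  1 ℕ.* (suc X C 1)                   ≡⟨ ℕₚ.+-identityʳ _ ⟨
  1 ℕ.* (suc X C 1) ℕ.+ 0 ℕ.* (suc X C 0) ∎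
C-absorption (suc X) (suc j) = begin
  suc X ℕ.* (suc X C suc j)
    ≡⟨ cong (suc X ℕ.*_) (nCk+nC[k+1]≡[n+1]C[k+1] X j) ⟨
  suc X ℕ.* (a ℕ.+ b)
    ≡⟨ expand X a b ⟩
  a ℕ.+ b ℕ.+ X ℕ.* a ℕ.+ X ℕ.* b
    ≡⟨ cong₂ (λ u v → a ℕ.+ b ℕ.+ u ℕ.+ v) (C-absorption X j) (C-absorption X (suc j)) ⟩
  a ℕ.+ b ℕ.+ (suc j ℕ.* b ℕ.+ j ℕ.* a) ℕ.+ (suc (suc j) ℕ.* c ℕ.+ suc j ℕ.* b)
    ≡⟨ regroup j a b c ⟩
  suc (suc j) ℕ.* (b ℕ.+ c) ℕ.+ suc j ℕ.* (a ℕ.+ b)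
    ≡⟨ cong₂ (λ u v → suc (suc j) ℕ.* u ℕ.+ suc j ℕ.* v)
         (nCk+nC[k+1]≡[n+1]C[k+1] X (suc j)) (nCk+nC[k+1]≡[n+1]C[k+1] X j) ⟩
  suc (suc j) ℕ.* (suc X C suc (suc j)) ℕ.+ suc j ℕ.* (suc X C suc j) ∎
  where
  a b c : ℕ
  a = X C j
  b = X C suc j
  c = X C suc (suc j)
  expand : ∀ x a b → suc x ℕ.* (a ℕ.+ b) ≡ a ℕ.+ b ℕ.+ x ℕ.* a ℕ.+ x ℕ.* b
  expand = ℕ-Tactic.solve-∀
  regroup : ∀ j a b c → a ℕ.+ b ℕ.+ (suc j ℕ.* b ℕ.+ j ℕ.* a) ℕ.+ (suc (suc j) ℕ.* c ℕ.+ suc j ℕ.* b)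
                        ≡ suc (suc j) ℕ.* (b ℕ.+ c) ℕ.+ suc j ℕ.* (a ℕ.+ b)
  regroup = ℕ-Tactic.solve-∀

nat-C-absorption : ∀ X j → (nat X + - nat j) * nat (X C j) ≡ nat (suc j) * nat (X C suc j)
nat-C-absorption X j = begin
  (nat X + - nat j) * nat (X C j)
    ≡⟨ solve 3 (λ x t c → (x :+ :- t) :* c := x :* c :+ :- (t :* c)) refl (nat X) (nat j) (nat (X C j)) ⟩
  nat X * nat (X C j) + - (nat j * nat (X C j))
    ≡⟨ cong (_+ - (nat j * nat (X C j))) absorption ⟩
  nat (suc j) * nat (X C suc j) + nat j * nat (X C j) + - (nat j * nat (X C j))
    ≡⟨ solve 2 (λ u v → u :+ v :+ :- v := u) refl (nat (suc j) * nat (X C suc j)) (nat j * nat (X C j)) ⟩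
  nat (suc j) * nat (X C suc j) ∎
  where
  absorption : nat X * nat (X C j) ≡ nat (suc j) * nat (X C suc j) + nat j * nat (X C j)
  absorption = begin
    nat X * nat (X C j)                                       ≡⟨ nat-* X _ ⟨
    nat (X ℕ.* (X C j))                                       ≡⟨ cong nat (C-absorption X j) ⟩
    nat (suc j ℕ.* (X C suc j) ℕ.+ j ℕ.* (X C j))             ≡⟨ nat-+ (suc j ℕ.* (X C suc j)) (j ℕ.* (X C j)) ⟩
    nat (suc j ℕ.* (X C suc j)) + nat (j ℕ.* (X C j))          ≡⟨ cong₂ _+_ (nat-* (suc j) (X C suc j)) (nat-* j (X C j)) ⟩
    nat (suc j) * nat (X C suc j) + nat j * nat (X C j)       ∎

stirlingExpansion≡j!*C : ∀ j X → stirlingExpansion j X ≡ nat (j !) * nat (X C j)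
stirlingExpansion≡j!*C zero    X = refl
stirlingExpansion≡j!*C (suc j) X = begin
  stirlingExpansion (suc j) X
    ≡⟨ stirlingExpansion-suc j X ⟩
  (nat X + - nat j) * stirlingExpansion j X
    ≡⟨ cong ((nat X + - nat j) *_) (stirlingExpansion≡j!*C j X) ⟩
  (nat X + - nat j) * (nat (j !) * nat (X C j))
    ≡⟨ solve 3 (λ d f c → d :* (f :* c) := f :* (d :* c)) refl (nat X + - nat j) (nat (j !)) (nat (X C j)) ⟩
  nat (j !) * ((nat X + - nat j) * nat (X C j))
    ≡⟨ cong (nat (j !) *_) (nat-C-absorption X j) ⟩
  nat (j !) * (nat (suc j) * nat (X C suc j))
    ≡⟨ solve 3 (λ f s c → f :* (s :* c) := s :* f :* c) refl (nat (j !)) (nat (suc j)) (nat (X C suc j)) ⟩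
  nat (suc j) * nat (j !) * nat (X C suc j)
    ≡⟨ cong (_* nat (X C suc j)) (nat-* (suc j) (j !)) ⟨
  nat (suc j !) * nat (X C suc j) ∎

Δ : (ℕ → ℚ) → ℕ → ℚ
Δ f x = f (suc x) + - f x

Δ^ : ℕ → (ℕ → ℚ) → ℕ → ℚ
Δ^ zero    f = f
Δ^ (suc j) f = Δ^ j (Δ f)

Δ^-suc : ∀ j f x → Δ^ (suc j) f x ≡ Δ^ j f (suc x) + - Δ^ j f x
Δ^-suc zero    f x = refl
Δ^-suc (suc j) f x = Δ^-suc j (Δ f) x

Δ^-shift : ∀ j f x → Δ^ j (f ∘ suc) x ≡ Δ^ j f (suc x)
Δ^-shift zero    f x = refl
Δ^-shift (suc j) f x = Δ^-shift j (Δ f) x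

Δ^-expansion : ∀ j f x → Δ^ j f x ≡ altSum j (λ m → nat (j C m)) (λ m → f (m ℕ.+ x))
Δ^-expansion zero    f x = solve 1 (λ y → y := con 1ℚ :* con 1ℚ :* y :+ con 0ℚ) refl (f x)
Δ^-expansion (suc j) f x = begin
  Δ^ (suc j) f x
    ≡⟨ Δ^-suc j f x ⟩
  Δ^ j f (suc x) + - Δ^ j f x
    ≡⟨ cong₂ (λ u v → u + - v) (Δ^-expansion j f (suc x)) (Δ^-expansion j f x) ⟩
  altSum j c (λ m → f (m ℕ.+ suc x)) + - V
    ≡⟨ cong (_+ - V) (sumFrom-cong 0 (suc j) λ m →
         cong (λ y → c m * negOnePow (j ∸ m) * f y) (ℕₚ.+-suc m x)) ⟩
  U + - V
    ≡⟨ solve 4 (λ e y u v → u :+ :- v := con 1ℚ :* (:- e) :* y :+ (u :+ (con 1ℚ :* e :* y :+ :- v)))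
         refl (negOnePow j) (h 0) U V ⟩
  1ℚ * - negOnePow j * h 0 + (U + (1ℚ * negOnePow j * h 0 + - V))
    ≡⟨ cong (λ s → 1ℚ * - negOnePow j * h 0 + (U + s))
         (altSum-shift j c h (cong nat (k>n⇒nCk≡0 (ℕₚ.n<1+n j)))) ⟨
  1ℚ * - negOnePow j * h 0 + (U + altSum j (c ∘ suc) (h ∘ suc))
    ≡⟨ cong (1ℚ * - negOnePow j * h 0 +_) (sumFrom-+ 0 (suc j) A B) ⟨
  1ℚ * - negOnePow j * h 0 + sumFrom 0 (suc j) (λ m → A m + B m)
    ≡⟨ cong (1ℚ * - negOnePow j * h 0 +_) (sumFrom-cong 0 (suc j) pascal) ⟩
  1ℚ * - negOnePow j * h 0 + altSum j (c′ ∘ suc) (h ∘ suc)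
    ≡⟨ altSum-suc j c′ h ⟨
  altSum (suc j) c′ h ∎
  where
  c c′ h A B : ℕ → ℚ
  c m = nat (j C m)
  c′ m = nat (suc j C m)
  h m = f (m ℕ.+ x)
  A m = c m * negOnePow (j ∸ m) * h (suc m)
  B m = c (suc m) * negOnePow (j ∸ m) * h (suc m)
  U V : ℚ
  U = altSum j c (h ∘ suc)
  V = altSum j c h
  pascal : ∀ m → A m + B m ≡ c′ (suc m) * negOnePow (j ∸ m) * h (suc m)
  pascal m = trans
    (solve 4 (λ a b e y → a :* e :* y :+ b :* e :* y := (a :+ b) :* e :* y) refl
      (c m) (c (suc m)) (negOnePow (j ∸ m)) (h (suc m)))
    (cong (λ z → z * negOnePow (j ∸ m) * h (suc m))
      (trans (sym (nat-+ (j C m) (j C suc m))) (cong nat (nCk+nC[k+1]≡[n+1]C[k+1] j m))))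

sumFrom-newton : ∀ n f → sumFrom 0 (suc n) f ≡ sumFrom 0 (suc n) (λ j → nat (suc n C suc j) * Δ^ j f 0)
sumFrom-newton zero    f = cong (_+ 0ℚ) (sym (ℚₚ.*-identityˡ (f 0)))
sumFrom-newton (suc n) f = begin
  f 0 + sumFrom 1 (suc n) f
    ≡⟨ cong (f 0 +_) (trans (sumFrom-shift 0 (suc n) f) (sumFrom-newton n (f ∘ suc))) ⟩
  f 0 + sumFrom 0 (suc n) (λ j → nat (suc n C suc j) * Δ^ j (f ∘ suc) 0)
    ≡⟨ cong (f 0 +_) (trans (sumFrom-cong 0 (suc n) split) (sumFrom-+ 0 (suc n) A B)) ⟩
  f 0 + (sumFrom 0 (suc n) A + sumFrom 0 (suc n) B)
    ≡⟨ solve 3 (λ y a b → y :+ (a :+ b) := (con 1ℚ :* y :+ a) :+ (b :+ con 0ℚ))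
         refl (f 0) (sumFrom 0 (suc n) A) (sumFrom 0 (suc n) B) ⟩
  (1ℚ * f 0 + sumFrom 0 (suc n) A) + (sumFrom 0 (suc n) B + 0ℚ)
    ≡⟨ cong₂ _+_ (cong (1ℚ * f 0 +_) (sumFrom-shift 0 (suc n) D))
                 (trans (sumFrom-snoc 0 (suc n) B) (cong (sumFrom 0 (suc n) B +_) B[1+n]≡0)) ⟨
  sumFrom 0 (suc (suc n)) D + sumFrom 0 (suc (suc n)) B
    ≡⟨ sumFrom-+ 0 (suc (suc n)) D B ⟨
  sumFrom 0 (suc (suc n)) (λ j → D j + B j)
    ≡⟨ sumFrom-cong 0 (suc (suc n)) pascal ⟩
  sumFrom 0 (suc (suc n)) (λ j → nat (suc (suc n) C suc j) * Δ^ j f 0) ∎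
  where
  A B D : ℕ → ℚ
  A j = nat (suc n C suc j) * Δ^ (suc j) f 0
  B j = nat (suc n C suc j) * Δ^ j f 0
  D j = nat (suc n C j) * Δ^ j f 0
  split : ∀ j → nat (suc n C suc j) * Δ^ j (f ∘ suc) 0 ≡ A j + B j
  split j = begin
    nat (suc n C suc j) * Δ^ j (f ∘ suc) 0
      ≡⟨ cong (nat (suc n C suc j) *_) (Δ^-shift j f 0) ⟩
    nat (suc n C suc j) * Δ^ j f 1
      ≡⟨ cong (nat (suc n C suc j) *_) (solve 2 (λ u v → u := (u :+ :- v) :+ v) refl (Δ^ j f 1) (Δ^ j f 0)) ⟩
    nat (suc n C suc j) * ((Δ^ j f 1 + - Δ^ j f 0) + Δ^ j f 0)
      ≡⟨ cong (λ d → nat (suc n C suc j) * (d + Δ^ j f 0)) (Δ^-suc j f 0) ⟨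
    nat (suc n C suc j) * (Δ^ (suc j) f 0 + Δ^ j f 0)
      ≡⟨ ℚₚ.*-distribˡ-+ (nat (suc n C suc j)) (Δ^ (suc j) f 0) (Δ^ j f 0) ⟩
    A j + B j ∎
  B[1+n]≡0 : B (suc n) ≡ 0ℚ
  B[1+n]≡0 = trans (cong (λ z → nat z * Δ^ (suc n) f 0) (k>n⇒nCk≡0 (ℕₚ.n<1+n (suc n))))
    (ℚₚ.*-zeroˡ (Δ^ (suc n) f 0))
  pascal : ∀ j → D j + B j ≡ nat (suc (suc n) C suc j) * Δ^ j f 0
  pascal j = trans (sym (ℚₚ.*-distribʳ-+ (Δ^ j f 0) (nat (suc n C j)) (nat (suc n C suc j))))
    (cong (_* Δ^ j f 0)
      (trans (sym (nat-+ (suc n C j) (suc n C suc j))) (cong nat (nCk+nC[k+1]≡[n+1]C[k+1] (suc n) j))))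

-- The value 0 at i = 0 kills the m = 0 term of Δʲf(0), matching S* whose sum starts at m = 1.
invPow : ℕ → ℕ → ℚ
invPow k zero    = 0ℚ
invPow k (suc i) = inv (suc i ℕ.^ k)

invPow-pos : ∀ k {i} → 1 ≤ i → invPow k i ≡ inv (i ℕ.^ k)
invPow-pos k {suc i} _ = refl

H≡sumFrom-invPow : ∀ n k → H n k ≡ sumFrom 0 (suc n) (invPow k)
H≡sumFrom-invPow n k = begin
  sumFrom 1 n (λ i → inv (i ℕ.^ k))  ≡⟨ sumFrom-cong-on 1 n (λ i 1≤i _ → sym (invPow-pos k 1≤i)) ⟩
  sumFrom 1 n (invPow k)             ≡⟨ ℚₚ.+-identityˡ _ ⟨
  sumFrom 0 (suc n) (invPow k)       ∎

Sstar≡Δ^-invPow : ∀ k j → Sstar (k ℕ.+ 2) j ≡ inv (j !) * Δ^ j (invPow k) 0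
Sstar≡Δ^-invPow k j = cong (inv (j !) *_) (sym (begin
  Δ^ j (invPow k) 0
    ≡⟨ Δ^-expansion j (invPow k) 0 ⟩
  c 0 * negOnePow j * 0ℚ + sumFrom 1 j (λ m → c m * negOnePow (j ∸ m) * invPow k (m ℕ.+ 0))
    ≡⟨ cong₂ _+_ (ℚₚ.*-zeroʳ (c 0 * negOnePow j)) (sumFrom-cong-on 1 j λ m 1≤m _ →
         cong (c m * negOnePow (j ∸ m) *_) (invPow[m+0] m 1≤m)) ⟩
  0ℚ + sumRange 1 j (λ m → c m * negOnePow (j ∸ m) * inv (m ℕ.^ (k ℕ.+ 2 ∸ 2)))
    ≡⟨ ℚₚ.+-identityˡ _ ⟩
  sumRange 1 j (λ m → c m * negOnePow (j ∸ m) * inv (m ℕ.^ (k ℕ.+ 2 ∸ 2))) ∎))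
  where
  c : ℕ → ℚ
  c m = nat (j C m)
  invPow[m+0] : ∀ m → 1 ≤ m → invPow k (m ℕ.+ 0) ≡ inv (m ℕ.^ (k ℕ.+ 2 ∸ 2))
  invPow[m+0] m 1≤m = begin
    invPow k (m ℕ.+ 0)          ≡⟨ cong (invPow k) (ℕₚ.+-identityʳ m) ⟩
    invPow k m                  ≡⟨ invPow-pos k 1≤m ⟩
    inv (m ℕ.^ k)               ≡⟨ cong (λ p → inv (m ℕ.^ p)) (ℕₚ.m+n∸n≡m k 2) ⟨
    inv (m ℕ.^ (k ℕ.+ 2 ∸ 2))   ∎

summand≡C*Δ^ : ∀ k n j →
  sumRange 0 (suc j) (λ m →
    nat (stirling1 (suc j) m) * Sstar (k ℕ.+ 2) j
      * (negOnePow (suc j ∸ m) * nat ((n ℕ.+ 1) ℕ.^ m) * inv (suc j)))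
  ≡ nat (suc n C suc j) * Δ^ j (invPow k) 0
summand≡C*Δ^ k n j = begin
  sumFrom 0 (suc (suc j)) (λ m → s m * S * (e m * x m * i))
    ≡⟨ sumFrom-cong 0 (suc (suc j)) (λ m →
         solve 5 (λ s S e x i → s :* S :* (e :* x :* i) := S :* i :* (s :* e :* x)) refl
           (s m) S (e m) (x m) i) ⟩
  sumFrom 0 (suc (suc j)) (λ m → S * i * (s m * e m * x m))
    ≡⟨ sumFrom-*ˡ 0 (suc (suc j)) (S * i) (λ m → s m * e m * x m) ⟩
  S * i * stirlingExpansion (suc j) (n ℕ.+ 1)
    ≡⟨ cong₂ (λ u v → u * i * v) (Sstar≡Δ^-invPow k j) (stirlingExpansion≡j!*C (suc j) (n ℕ.+ 1)) ⟩
  inv (j !) * D * i * (nat (suc j !) * nat ((n ℕ.+ 1) C suc j))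
    ≡⟨ cong₂ (λ u v → inv (j !) * D * i * (u * nat (v C suc j))) (nat-* (suc j) (j !)) (ℕₚ.+-comm n 1) ⟩
  inv (j !) * D * i * (nat (suc j) * nat (j !) * nat (suc n C suc j))
    ≡⟨ solve 6 (λ a d i s f b → a :* d :* i :* (s :* f :* b) := a :* f :* (i :* s) :* (b :* d)) refl
         (inv (j !)) D i (nat (suc j)) (nat (j !)) (nat (suc n C suc j)) ⟩
  inv (j !) * nat (j !) * (i * nat (suc j)) * (nat (suc n C suc j) * D)
    ≡⟨ cong₂ (λ u v → u * v * (nat (suc n C suc j) * D)) (inv-*-nat (j !) {{j ℕₚ.!≢0}}) (inv-*-nat (suc j)) ⟩
  1ℚ * 1ℚ * (nat (suc n C suc j) * D)
    ≡⟨ solve 1 (λ y → con 1ℚ :* con 1ℚ :* y := y) refl (nat (suc n C suc j) * D) ⟩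
  nat (suc n C suc j) * D ∎
  where
  s e x : ℕ → ℚ
  s m = nat (stirling1 (suc j) m)
  e m = negOnePow (suc j ∸ m)
  x m = nat ((n ℕ.+ 1) ℕ.^ m)
  S i D : ℚ
  S = Sstar (k ℕ.+ 2) j
  i = inv (suc j)
  D = Δ^ j (invPow k) 0

proposition3p5 : (k n : ℕ) →
    H n k ≡ sumRange 0 n (λ j → sumRange 0 (ℕ.suc j) (λ m →
      nat (stirling1 (ℕ.suc j) m) * Sstar (k ℕ.+ 2) j
        * (negOnePow (ℕ.suc j ∸ m) * nat ((n ℕ.+ 1) ℕ.^ m) * inv (ℕ.suc j))))
proposition3p5 k n = begin
  H n k                                                                ≡⟨ H≡sumFrom-invPow n k ⟩
  sumFrom 0 (suc n) (invPow k)                                         ≡⟨ sumFrom-newton n (invPow k) ⟩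
  sumFrom 0 (suc n) (λ j → nat (suc n C suc j) * Δ^ j (invPow k) 0)    ≡⟨ sumFrom-cong 0 (suc n) (summand≡C*Δ^ k n) ⟨
  _                                                                    ∎
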